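{- Let $h,w\ge 4$ and let $G=C_w(U)\sqcap C_h$ with $U=\{i,j\}\subseteq\{1,\dots,w\}$, $i<j$. 1. If $j=i+1$, then $Z(G)\le h$. 2. If $j\neq i+1$, then $Z(G)\le 2h$.
   Context: All graphs are finite, simple and undirected. The cycle $C_n$ ($n\ge3$) has vertex set $\{1,\dots,n\}$ and edges $\{k,k+1\}$ for $1\le k\le n-1$ together with $\{n,1\}$. For graphs $W,H$ and a subset $U\subseteq V(W)$ (the root set), the (generalized) hierarchical product $W(U)\sqcap H$ is the graph with vertex set $V(W)\times V(H)$ in which $(x_1,y_1)$ and $(x_2,y_2)$ are adjacent if and only if either ($x_1=x_2\in U$ and $y_1y_2\in E(H)$) or ($y_1=y_2$ and $x_1x_2\in E(W)$). Zero forcing: starting from a set $S$ of filled vertices, repeatedly apply the color change rule: if a filled vertex has exactly one unfilled neighbor, that neighbor becomes filled. $S$ is a zero forcing set if this eventually fills every vertex. The zero forcing number $Z(G)$ is the minimum size of a zero forcing set of $G$. -}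

module Defs where

open import Data.Nat using (ℕ; zero; suc; _≤_; _∸_)
open import Data.Fin using (Fin; toℕ)
open import Data.Product using (_×_; _,_; Σ; proj₁; proj₂)
open import Data.Sum using (_⊎_)
open import Data.List using (List; length)
open import Data.List.Membership.Propositional using (_∈_)
open import Relation.Binary.PropositionalEquality using (_≡_; _≢_)
open import Level using (0ℓ)

record Graph : Set₁ where
  field
    V   : Set
    Adj : V → V → Set
open Graph public

-- Cycle C_n on vertex set Fin n, where Fin-index a stands for vertex a+1.
-- Edges {k,k+1} (1 ≤ k ≤ n-1) and {n,1}.
CycAdj : (n : ℕ) → Fin n → Fin n → Set
CycAdj n a b =
  (toℕ b ≡ suc (toℕ a)) ⊎ (toℕ a ≡ suc (toℕ b)) ⊎
  ((toℕ a ≡ 0 × toℕ b ≡ n ∸ 1) ⊎ (toℕ b ≡ 0 × toℕ a ≡ n ∸ 1))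

Cycle : ℕ → Graph
Cycle n = record { V = Fin n ; Adj = CycAdj n }

HierProd : (W : Graph) → (U : V W → Set) → (H : Graph) → Graph
HierProd W U H = record
  { V = V W × V H
  ; Adj = λ p q →
      ((proj₁ p ≡ proj₁ q) × U (proj₁ p) × Adj H (proj₂ p) (proj₂ q))
      ⊎ ((proj₂ p ≡ proj₂ q) × Adj W (proj₁ p) (proj₁ q))
  }

data Filled (G : Graph) (S : List (V G)) : V G → Set where
  init  : ∀ {v} → v ∈ S → Filled G S v
  force : ∀ {u v} → Filled G S u → Adj G u v →
          (∀ x → Adj G u x → x ≢ v → Filled G S x) →
          Filled G S v

IsZeroForcingSet : (G : Graph) → List (V G) → Set
IsZeroForcingSet G S = ∀ v → Filled G S v

ZLe : Graph → ℕ → Set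
ZLe G k = Σ (List (V G)) λ S → IsZeroForcingSet G S × length S ≤ k

CwUCh : (w h : ℕ) → Fin w → Fin w → Graph
CwUCh w h i j = HierProd (Cycle w) (λ x → (x ≡ i) ⊎ (x ≡ j)) (Cycle h)

-- For adjacent roots, rotating the cycle C_w is an automorphism that moves the
-- roots, so it suffices to treat the roots 0 and 1.  There the set S made of
-- (2,0), (2,1) and (1,t) for 1 ≤ t ≤ h-2 forces everything: a row in which
-- columns 1 and 2 are filled fills itself by sweeping through the non-root
-- columns 2, …, w-1 and back to 0; this gives rows 1 and 0, then all of
-- column 1, and from two consecutive filled rows the root column 0 forces the
-- next row, where column 1 forces column 2.  For arbitrary roots, two
-- consecutive full columns force every further column along the cycle.
module Submission where

open import Defs
open import Data.Nat using (ℕ; zero; suc; _+_; _*_; _∸_; _≤_; _<_; NonZero; z≤n; s≤s; s≤s⁻¹)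
open import Data.Nat.Properties using (+-suc; +-comm; +-identityʳ; ≤-refl; ≤-reflexive; <-trans; n<1+n; m≤n⇒m<n∨m≡n)
open import Data.Nat.DivMod using (_%_; _mod_; m%n<n; m<n⇒m%n≡m; n%n≡0; m%n%n≡m%n; %-distribˡ-+; [m+n]%n≡m%n)
open import Data.Fin using (Fin; toℕ)
open import Data.Fin.Properties using (toℕ<n; toℕ-fromℕ<; toℕ-injective)
open import Data.Product using (_×_; _,_; proj₁; proj₂)
open import Data.Sum using (_⊎_; inj₁; inj₂)
import Data.Sum as Sum
open import Data.Empty using (⊥-elim)
open import Data.List using (List; _∷_; _++_; map; tabulate; upTo; length)
open import Data.List.Properties using (length-++; length-map; length-tabulate; length-upTo)
open import Data.List.Membership.Propositional.Properties using (∈-map⁺; ∈-tabulate⁺; ∈-++⁺ˡ; ∈-++⁺ʳ; ∈-upTo⁺)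
open import Data.List.Relation.Unary.Any using (here; there)
open import Relation.Nullary using (¬_)
open import Relation.Binary.PropositionalEquality

suc[n∸1]≡n : ∀ n .{{_ : NonZero n}} → suc (n ∸ 1) ≡ n
suc[n∸1]≡n (suc _) = refl

%-absorbˡ : ∀ m k n .{{_ : NonZero n}} → (m % n + k) % n ≡ (m + k) % n
%-absorbˡ m k n = begin
  (m % n + k) % n          ≡⟨ %-distribˡ-+ (m % n) k n ⟩
  (m % n % n + k % n) % n  ≡⟨ cong (λ r → (r + k % n) % n) (m%n%n≡m%n m n) ⟩
  (m % n + k % n) % n      ≡⟨ %-distribˡ-+ m k n ⟨
  (m + k) % n              ∎
  where open ≡-Reasoning

suc-% : ∀ m n .{{_ : NonZero n}} → suc (m % n) % n ≡ suc m % n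
suc-% m n = begin
  suc (m % n) % n  ≡⟨ cong (_% n) (+-comm 1 (m % n)) ⟩
  (m % n + 1) % n  ≡⟨ %-absorbˡ m 1 n ⟩
  (m + 1) % n      ≡⟨ cong (_% n) (+-comm m 1) ⟩
  suc m % n        ∎
  where open ≡-Reasoning

module _ {n : ℕ} .{{_ : NonZero n}} where

  toℕ-mod : ∀ k → toℕ (k mod n) ≡ k % n
  toℕ-mod k = toℕ-fromℕ< (m%n<n k n)

  mod-toℕ : ∀ x → toℕ x mod n ≡ x
  mod-toℕ x = toℕ-injective (trans (toℕ-mod (toℕ x)) (m<n⇒m%n≡m (toℕ<n x)))

  elim-mod : ∀ {p} (P : Fin n → Set p) → (∀ k → k < n → P (k mod n)) → ∀ x → P x
  elim-mod P P-mod x = subst P (mod-toℕ x) (P-mod (toℕ x) (toℕ<n x))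

  mod-injective : ∀ {k l} → k < n → l < n → k mod n ≡ l mod n → k ≡ l
  mod-injective {k} {l} k<n l<n eq = begin
    k       ≡⟨ m<n⇒m%n≡m k<n ⟨
    k % n   ≡⟨ trans (sym (toℕ-mod k)) (trans (cong toℕ eq) (toℕ-mod l)) ⟩
    l % n   ≡⟨ m<n⇒m%n≡m l<n ⟩
    l       ∎
    where open ≡-Reasoning

  %≡⇒mod≡ : ∀ {k l} → k % n ≡ l % n → k mod n ≡ l mod n
  %≡⇒mod≡ {k} {l} eq = toℕ-injective (trans (toℕ-mod k) (trans eq (sym (toℕ-mod l))))

  mod-+n : ∀ k → (k + n) mod n ≡ k mod n
  mod-+n k = %≡⇒mod≡ ([m+n]%n≡m%n k n)

  next : Fin n → Fin n
  next x = suc (toℕ x) mod n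

  prev : Fin n → Fin n
  prev x = (toℕ x + (n ∸ 1)) mod n

  next-mod : ∀ k → next (k mod n) ≡ suc k mod n
  next-mod k = %≡⇒mod≡ (trans (cong (λ r → suc r % n) (toℕ-mod k)) (suc-% k n))

  private
    [1+k+n∸1]%n≡k%n : ∀ k → suc (k + (n ∸ 1)) % n ≡ k % n
    [1+k+n∸1]%n≡k%n k = begin
      suc (k + (n ∸ 1)) % n  ≡⟨ cong (_% n) (trans (sym (+-suc k (n ∸ 1))) (cong (k +_) (suc[n∸1]≡n n))) ⟩
      (k + n) % n            ≡⟨ [m+n]%n≡m%n k n ⟩
      k % n                  ∎
      where open ≡-Reasoning

  prev-next : ∀ x → prev (next x) ≡ x
  prev-next x = trans (%≡⇒mod≡ (begin
    (toℕ (next x) + (n ∸ 1)) % n     ≡⟨ cong (λ r → (r + (n ∸ 1)) % n) (toℕ-mod (suc (toℕ x))) ⟩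
    (suc (toℕ x) % n + (n ∸ 1)) % n  ≡⟨ %-absorbˡ (suc (toℕ x)) (n ∸ 1) n ⟩
    suc (toℕ x + (n ∸ 1)) % n        ≡⟨ [1+k+n∸1]%n≡k%n (toℕ x) ⟩
    toℕ x % n                        ∎)) (mod-toℕ x)
    where open ≡-Reasoning

  next-prev : ∀ x → next (prev x) ≡ x
  next-prev x =
    trans (next-mod (toℕ x + (n ∸ 1))) (trans (%≡⇒mod≡ ([1+k+n∸1]%n≡k%n (toℕ x))) (mod-toℕ x))

  next-injective : ∀ {x y} → next x ≡ next y → x ≡ y
  next-injective {x} {y} eq = trans (sym (prev-next x)) (trans (cong prev eq) (prev-next y))

  infix 4 _∼_
  _∼_ : Fin n → Fin n → Set
  x ∼ y = y ≡ next x ⊎ x ≡ next y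

  next-∼ : ∀ {x y} → x ∼ y → next x ∼ next y
  next-∼ (inj₁ eq) = inj₁ (cong next eq)
  next-∼ (inj₂ eq) = inj₂ (cong next eq)

  ∼-next : ∀ {x y} → next x ∼ next y → x ∼ y
  ∼-next (inj₁ eq) = inj₁ (next-injective eq)
  ∼-next (inj₂ eq) = inj₂ (next-injective eq)

  neighbours-mod : ∀ {k x} → suc k mod n ∼ x → x ≡ suc (suc k) mod n ⊎ x ≡ k mod n
  neighbours-mod {k} (inj₁ eq) = inj₁ (trans eq (next-mod (suc k)))
  neighbours-mod {k} (inj₂ eq) = inj₂ (next-injective (trans (sym eq) (sym (next-mod k))))

  private
    Follows : Fin n → Fin n → Set
    Follows x y = toℕ y ≡ suc (toℕ x) ⊎ (toℕ y ≡ 0 × toℕ x ≡ n ∸ 1)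

    ≡next⇒Follows : ∀ {x y} → y ≡ next x → Follows x y
    ≡next⇒Follows {x} refl with m≤n⇒m<n∨m≡n (toℕ<n x)
    ... | inj₁ 1+x<n = inj₁ (trans (toℕ-mod (suc (toℕ x))) (m<n⇒m%n≡m 1+x<n))
    ... | inj₂ 1+x≡n = inj₂ (trans (toℕ-mod (suc (toℕ x))) (trans (cong (_% n) 1+x≡n) (n%n≡0 n))
                            , cong (_∸ 1) 1+x≡n)

    Follows⇒≡next : ∀ {x y} → Follows x y → y ≡ next x
    Follows⇒≡next {x} {y} (inj₁ y≡1+x) = toℕ-injective (begin
      toℕ y            ≡⟨ m<n⇒m%n≡m (toℕ<n y) ⟨
      toℕ y % n        ≡⟨ cong (_% n) y≡1+x ⟩
      suc (toℕ x) % n  ≡⟨ toℕ-mod (suc (toℕ x)) ⟨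
      toℕ (next x)     ∎)
      where open ≡-Reasoning
    Follows⇒≡next {x} {y} (inj₂ (y≡0 , x≡n∸1)) = toℕ-injective (begin
      toℕ y            ≡⟨ y≡0 ⟩
      0                ≡⟨ n%n≡0 n ⟨
      n % n            ≡⟨ cong (_% n) (trans (sym (suc[n∸1]≡n n)) (cong suc (sym x≡n∸1))) ⟩
      suc (toℕ x) % n  ≡⟨ toℕ-mod (suc (toℕ x)) ⟨
      toℕ (next x)     ∎)
      where open ≡-Reasoning

  CycAdj⇒∼ : ∀ {x y} → CycAdj n x y → x ∼ y
  CycAdj⇒∼ (inj₁ e)               = inj₁ (Follows⇒≡next (inj₁ e))
  CycAdj⇒∼ (inj₂ (inj₁ e))        = inj₂ (Follows⇒≡next (inj₁ e))
  CycAdj⇒∼ (inj₂ (inj₂ (inj₁ e))) = inj₂ (Follows⇒≡next (inj₂ e))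
  CycAdj⇒∼ (inj₂ (inj₂ (inj₂ e))) = inj₁ (Follows⇒≡next (inj₂ e))

  ∼⇒CycAdj : ∀ {x y} → x ∼ y → CycAdj n x y
  ∼⇒CycAdj (inj₁ e) with ≡next⇒Follows e
  ... | inj₁ f = inj₁ f
  ... | inj₂ f = inj₂ (inj₂ (inj₂ f))
  ∼⇒CycAdj (inj₂ e) with ≡next⇒Follows e
  ... | inj₁ f = inj₂ (inj₁ f)
  ... | inj₂ f = inj₂ (inj₂ (inj₁ f))

ZLe-transport : ∀ {G G′ : Graph} {k} (φ : V G → V G′) (ψ : V G′ → V G) →
  (∀ v → φ (ψ v) ≡ v) →
  (∀ {u v} → Adj G u v → Adj G′ (φ u) (φ v)) →
  (∀ {u v} → Adj G′ (φ u) (φ v) → Adj G u v) →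
  ZLe G k → ZLe G′ k
ZLe-transport {G} {G′} {k} φ ψ φ∘ψ adj⁺ adj⁻ (S , S-forces , |S|≤k) =
  map φ S , forces , subst (_≤ k) (sym (length-map φ S)) |S|≤k
  where
  filled-map : ∀ {v} → Filled G S v → Filled G′ (map φ S) (φ v)
  filled-map (init v∈S) = init (∈-map⁺ φ v∈S)
  filled-map {v} (force {u} u-filled u~v others) =
    force (filled-map u-filled) (adj⁺ u~v) λ x u~x x≢v →
      subst (Filled G′ (map φ S)) (φ∘ψ x)
        (filled-map (others (ψ x) (adj⁻ (subst (Adj G′ (φ u)) (sym (φ∘ψ x)) u~x))
                              (λ ψx≡v → x≢v (trans (sym (φ∘ψ x)) (cong φ ψx≡v)))))

  forces : IsZeroForcingSet G′ (map φ S)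
  forces x = subst (Filled G′ (map φ S)) (φ∘ψ x) (filled-map (S-forces (ψ x)))

ZLe-rotate : ∀ {w h k} .{{_ : NonZero w}} {a b : Fin w} →
  ZLe (CwUCh w h a b) k → ZLe (CwUCh w h (next a) (next b)) k
ZLe-rotate {w} {h} {_} {a} {b} =
  ZLe-transport (λ (x , y) → next x , y) (λ (x , y) → prev x , y)
    (λ (x , y) → cong (_, y) (next-prev x)) adj⁺ adj⁻
  where
  adj⁺ : ∀ {u v} → Adj (CwUCh w h a b) u v →
    Adj (CwUCh w h (next a) (next b)) (next (proj₁ u) , proj₂ u) (next (proj₁ v) , proj₂ v)
  adj⁺ (inj₁ (refl , root , y~y′)) = inj₁ (refl , Sum.map (cong next) (cong next) root , y~y′)
  adj⁺ (inj₂ (refl , x~x′))        = inj₂ (refl , ∼⇒CycAdj (next-∼ (CycAdj⇒∼ x~x′)))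

  adj⁻ : ∀ {u v} → Adj (CwUCh w h (next a) (next b)) (next (proj₁ u) , proj₂ u) (next (proj₁ v) , proj₂ v) →
    Adj (CwUCh w h a b) u v
  adj⁻ (inj₁ (eq , root , y~y′)) = inj₁ (next-injective eq , Sum.map next-injective next-injective root , y~y′)
  adj⁻ (inj₂ (eq , x~x′))        = inj₂ (eq , ∼⇒CycAdj (∼-next (CycAdj⇒∼ x~x′)))

ZLe-shift : ∀ {w h k} .{{_ : NonZero w}} → ZLe (CwUCh w h (0 mod w) (1 mod w)) k →
  ∀ t → ZLe (CwUCh w h (t mod w) (suc t mod w)) k
ZLe-shift base zero = base
ZLe-shift {w} {h} {k} base (suc t) =
  subst₂ (λ a b → ZLe (CwUCh w h a b) k) (next-mod t) (next-mod (suc t)) (ZLe-rotate (ZLe-shift base t))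

module Forcing {w h : ℕ} .{{_ : NonZero w}} .{{_ : NonZero h}}
               (a b : Fin w) (S : List (Fin w × Fin h)) where

  Root : Fin w → Set
  Root x = x ≡ a ⊎ x ≡ b

  IsFilled : Fin w → Fin h → Set
  IsFilled x y = Filled (CwUCh w h a b) S (x , y)

  Row : Fin h → Set
  Row y = ∀ x → IsFilled x y

  Column : Fin w → Set
  Column x = ∀ y → IsFilled x y

  col : ℕ → Fin w
  col k = k mod w

  row : ℕ → Fin h
  row t = t mod h

  forceAlongRow : ∀ {x x′ y} → IsFilled x y → x ∼ x′ →
    (∀ {c} → x ∼ c → c ≢ x′ → IsFilled c y) →
    (Root x → ∀ {d} → y ∼ d → IsFilled x d) →
    IsFilled x′ y
  forceAlongRow {x} {x′} {y} xy-filled x~x′ horizontal vertical =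
    force xy-filled (inj₂ (refl , ∼⇒CycAdj x~x′)) others
    where
    others : ∀ v → Adj (CwUCh w h a b) (x , y) v → v ≢ (x′ , y) → Filled (CwUCh w h a b) S v
    others _ (inj₁ (refl , root , y~d)) _ = vertical root (CycAdj⇒∼ y~d)
    others _ (inj₂ (refl , x~c))        ne = horizontal (CycAdj⇒∼ x~c) (λ c≡x′ → ne (cong (_, y) c≡x′))

  forceAlongColumn : ∀ {x y y′} → Root x → IsFilled x y → y ∼ y′ →
    (∀ {c} → x ∼ c → IsFilled c y) →
    (∀ {d} → y ∼ d → d ≢ y′ → IsFilled x d) →
    IsFilled x y′
  forceAlongColumn {x} {y} {y′} root xy-filled y~y′ horizontal vertical =
    force xy-filled (inj₁ (refl , root , ∼⇒CycAdj y~y′)) others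
    where
    others : ∀ v → Adj (CwUCh w h a b) (x , y) v → v ≢ (x , y′) → Filled (CwUCh w h a b) S v
    others _ (inj₁ (refl , _ , y~d)) ne = vertical (CycAdj⇒∼ y~d) (λ d≡y′ → ne (cong (x ,_) d≡y′))
    others _ (inj₂ (refl , x~c))     _  = horizontal (CycAdj⇒∼ x~c)

  forceRight : ∀ {k y} → IsFilled (col k) y → IsFilled (col (suc k)) y →
    (Root (col (suc k)) → ∀ {d} → y ∼ d → IsFilled (col (suc k)) d) →
    IsFilled (col (suc (suc k))) y
  forceRight {k} {y} left centre vertical =
    forceAlongRow centre (inj₁ (sym (next-mod (suc k)))) horizontal vertical
    where
    horizontal : ∀ {c} → col (suc k) ∼ c → c ≢ col (suc (suc k)) → IsFilled c y
    horizontal c~ ne with neighbours-mod c~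
    ... | inj₁ c≡right = ⊥-elim (ne c≡right)
    ... | inj₂ refl    = left

  forceUp : ∀ {x t} → Root x → IsFilled x (row t) → IsFilled x (row (suc t)) →
    (∀ {c} → x ∼ c → IsFilled c (row (suc t))) →
    IsFilled x (row (suc (suc t)))
  forceUp {x} {t} root below centre horizontal =
    forceAlongColumn root centre (inj₁ (sym (next-mod (suc t)))) horizontal vertical
    where
    vertical : ∀ {d} → row (suc t) ∼ d → d ≢ row (suc (suc t)) → IsFilled x d
    vertical d~ ne with neighbours-mod d~
    ... | inj₁ d≡above = ⊥-elim (ne d≡above)
    ... | inj₂ refl    = below

  forceDown : ∀ {x t} → Root x → IsFilled x (row (suc t)) → IsFilled x (row (suc (suc t))) →
    (∀ {c} → x ∼ c → IsFilled c (row (suc t))) →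
    IsFilled x (row t)
  forceDown {x} {t} root centre above horizontal =
    forceAlongColumn root centre (inj₂ (sym (next-mod t))) horizontal vertical
    where
    vertical : ∀ {d} → row (suc t) ∼ d → d ≢ row t → IsFilled x d
    vertical d~ ne with neighbours-mod d~
    ... | inj₁ refl    = above
    ... | inj₂ d≡below = ⊥-elim (ne d≡below)

  all-columns : Column (col 0) → Column (col 1) → ∀ x → Column x
  all-columns column₀ column₁ = elim-mod Column (λ k _ → proj₁ (consecutive k))
    where
    consecutive : ∀ k → Column (col k) × Column (col (suc k))
    consecutive zero = column₀ , column₁
    consecutive (suc k) with consecutive k
    ... | left , centre = centre , λ y → forceRight (left y) (centre y) (λ _ _ → centre _)

ZLe-two-columns : ∀ {w h} .{{_ : NonZero w}} .{{_ : NonZero h}} (a b : Fin w) → ZLe (CwUCh w h a b) (2 * h)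
ZLe-two-columns {w} {h} a b = S , forces , ≤-reflexive |S|≡2h
  where
  column₀ column₁ : List (Fin w × Fin h)
  column₀ = tabulate (0 mod w ,_)
  column₁ = tabulate (1 mod w ,_)

  S : List (Fin w × Fin h)
  S = column₀ ++ column₁

  |S|≡2h : length S ≡ 2 * h
  |S|≡2h = trans (length-++ column₀)
                 (cong₂ _+_ (length-tabulate {n = h} (0 mod w ,_))
                             (trans (length-tabulate {n = h} (1 mod w ,_)) (sym (+-identityʳ h))))

  open Forcing a b S

  forces : IsZeroForcingSet (CwUCh w h a b) S
  forces (x , y) = all-columns (λ y → init (∈-++⁺ˡ (∈-tabulate⁺ y)))
                               (λ y → init (∈-++⁺ʳ column₀ (∈-tabulate⁺ y))) x y

module AdjacentRoots (m n : ℕ) where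

  private
    w h : ℕ
    w = 3 + m
    h = 4 + n

    S : List (Fin w × Fin h)
    S = (2 mod w , 0 mod h) ∷ (2 mod w , 1 mod h) ∷ map (λ t → 1 mod w , suc t mod h) (upTo (2 + n))

  open Forcing (0 mod w) (1 mod w) S

  private
    non-root : ∀ {k} → 2 ≤ k → k < w → ¬ Root (col k)
    non-root (s≤s (s≤s _)) k<w (inj₁ eq) with () ← mod-injective k<w (s≤s z≤n) eq
    non-root (s≤s (s≤s _)) k<w (inj₂ eq) with () ← mod-injective k<w (s≤s (s≤s z≤n)) eq

    column₁-inner : ∀ {t} → t < 2 + n → IsFilled (col 1) (row (suc t))
    column₁-inner t<2+n = init (there (there (∈-map⁺ (λ t → 1 mod w , suc t mod h) (∈-upTo⁺ t<2+n))))

    row-from-columns-1-2 : ∀ {y} → IsFilled (col 1) y → IsFilled (col 2) y → Row y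
    row-from-columns-1-2 {y} filled₁ filled₂ = elim-mod (λ x → IsFilled x y) fill
      where
      sweep : ∀ k → k < w → IsFilled (col (suc k)) y
      sweep zero _ = filled₁
      sweep (suc zero) _ = filled₂
      sweep (suc (suc k)) 2+k<w =
        forceRight {k = suc k} (sweep k (<-trans (n<1+n k) 1+k<w)) (sweep (suc k) 1+k<w)
                   (λ root → ⊥-elim (non-root (s≤s (s≤s z≤n)) 2+k<w root))
        where 1+k<w = <-trans (n<1+n (suc k)) 2+k<w

      fill : ∀ k → k < w → IsFilled (col k) y
      fill zero _ = subst (λ x → IsFilled x y) (mod-+n 0) (sweep (2 + m) ≤-refl)
      fill (suc k) 1+k<w = sweep k (<-trans (n<1+n k) 1+k<w)

    row₁ : Row (row 1)
    row₁ = row-from-columns-1-2 (column₁-inner (s≤s z≤n)) (init (there (here refl)))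

    row₀ : Row (row 0)
    row₀ = row-from-columns-1-2
      (forceDown {t = 0} (inj₂ refl) (column₁-inner (s≤s z≤n)) (column₁-inner (s≤s (s≤s z≤n))) (λ _ → row₁ _))
      (init (here refl))

    column₁ : Column (col 1)
    column₁ = elim-mod (IsFilled (col 1)) fill
      where
      fill : ∀ t → t < h → IsFilled (col 1) (row t)
      fill zero _ = row₀ _
      fill (suc t) 1+t<h with m≤n⇒m<n∨m≡n (s≤s⁻¹ (s≤s⁻¹ 1+t<h))
      ... | inj₁ t<2+n = column₁-inner t<2+n
      -- the top row h − 1 is forced from row 0 = row h, going down around C_h
      ... | inj₂ refl  = forceDown {t = 3 + n} (inj₂ refl)
        (subst (IsFilled (col 1)) (sym (mod-+n 0)) (row₀ _))
        (subst (IsFilled (col 1)) (sym (mod-+n 1)) (row₁ _))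
        (λ _ → subst (IsFilled _) (sym (mod-+n 0)) (row₀ _))

    next-row : ∀ {t} → Row (row t) → Row (row (suc t)) → Row (row (suc (suc t)))
    next-row {t} below centre = row-from-columns-1-2 (column₁ _)
      (forceRight {k = 0} (forceUp {t = t} (inj₁ refl) (below _) (centre _) (λ _ → centre _))
                  (column₁ _) (λ _ _ → column₁ _))

    all-rows : ∀ y → Row y
    all-rows = elim-mod Row (λ t _ → proj₁ (consecutive t))
      where
      consecutive : ∀ t → Row (row t) × Row (row (suc t))
      consecutive zero = row₀ , row₁
      consecutive (suc t) with consecutive t
      ... | below , centre = centre , next-row {t} below centre

  ZLe-adjacent-roots : ZLe (CwUCh w h (0 mod w) (1 mod w)) h
  ZLe-adjacent-roots =
    S , (λ (x , y) → all-rows y x) , ≤-reflexive (cong (2 +_) (trans (length-map _ (upTo (2 + n))) (length-upTo (2 + n))))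

mainTheorem4 : (w h : ℕ) → 4 ≤ w → 4 ≤ h → (i j : Fin w) → toℕ i < toℕ j →
    ((toℕ j ≡ suc (toℕ i) → ZLe (CwUCh w h i j) h)
    × (toℕ j ≢ suc (toℕ i) → ZLe (CwUCh w h i j) (2 * h)))
mainTheorem4 w h (s≤s (s≤s (s≤s (s≤s {n = m} _)))) (s≤s (s≤s (s≤s (s≤s {n = n} _)))) i j _ =
  adjacent , λ _ → ZLe-two-columns i j
  where
  adjacent : toℕ j ≡ suc (toℕ i) → ZLe (CwUCh w h i j) h
  adjacent j≡1+i =
    subst₂ (λ a b → ZLe (CwUCh w h a b) h) (mod-toℕ i) (trans (cong (_mod w) (sym j≡1+i)) (mod-toℕ j))
      (ZLe-shift (AdjacentRoots.ZLe-adjacent-roots (suc m) n) (toℕ i))
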